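{- For every dealing pattern $P$, $M^P(0)=0$, and for every integer $N\ge 1$, \[M^{P}(N)=M^{P'}\bigl(N-|P_N|_D\bigr)+N,\] where $P'$ is the pattern obtained from $P$ by deleting its first $N$ letters.
   Context: A dealing pattern $P=P_1P_2P_3\cdots$ is an infinite sequence of letters $U$ and $D$ containing infinitely many $D$'s. Dealing a deck of $N$ cards by $P$ means: process the letters $P_1,P_2,\dots$ in order; for a $U$ move the top card to the bottom of the deck; for a $D$ remove the top card from the deck (deal it); stop as soon as all $N$ cards have been dealt. $M^P(N)$ is the total number of letters processed when dealing $N$ cards by $P$ (so $M^P(0)=0$). $|P_m|_D$ and $|P_m|_U$ denote the number of occurrences of $D$, resp. $U$, among the first $m$ letters of $P$. -}

module Defs where

open import Data.Nat using (ℕ; zero; suc; _+_; _∸_)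
open import Data.Nat.Properties using (+-assoc)
open import Data.Bool using (Bool; true; false; if_then_else_)
open import Data.List using (List; []; _∷_; _++_; [_]; null; upTo)
open import Data.Product using (Σ; ∃; _,_; proj₁; proj₂)
open import Relation.Binary.PropositionalEquality using (_≡_; subst; sym)

data Letter : Set where
  U D : Letter

-- A dealing pattern P = P₁P₂P₃⋯ : the letter P_{i+1} is  seq i  (0-based indexing).
-- "infinitely many D's": for every n there is a D at some position n + m.
record Pattern : Set where
  field
    seq  : ℕ → Letter
    infD : ∀ n → ∃ λ m → seq (n + m) ≡ D
open Pattern public

-- One letter applied to a deck (a list of cards, head = top card).
step : Letter → List ℕ → List ℕ
step _ []       = []
step U (x ∷ xs) = xs ++ [ x ]
step D (x ∷ xs) = xs

deckAfter : (ℕ → Letter) → List ℕ → ℕ → List ℕ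
deckAfter p d zero    = d
deckAfter p d (suc k) = step (p k) (deckAfter p d k)

deck : ℕ → List ℕ
deck N = upTo N

-- least k ≤ b with f k ≡ true (returns b if there is none).
least : (ℕ → Bool) → ℕ → ℕ
least f zero    = zero
least f (suc b) = if f zero then zero else suc (least (λ k → f (suc k)) b)

-- bnd P n : a number of letters among which at least n letters are D
-- (obtained from the infinitely-many-D's witness); it bounds the search.
bnd : Pattern → ℕ → ℕ
bnd P zero    = zero
bnd P (suc n) = suc (bnd P n + proj₁ (infD P (bnd P n)))

-- M^P(N): number of letters processed when dealing N cards by P, i.e. the
-- least k such that the deck is empty after processing k letters
-- (dealing stops as soon as all N cards are dealt).
M : Pattern → ℕ → ℕ
M P N = least (λ k → null (deckAfter (seq P) (deck N) k)) (bnd P N)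

countD : Pattern → ℕ → ℕ
countD P zero = zero
countD P (suc m) with seq P m
... | D = suc (countD P m)
... | U = countD P m

dropP : ℕ → Pattern → Pattern
seq  (dropP N P) i = seq P (N + i)
infD (dropP N P) n =
  proj₁ (infD P (N + n)) ,
  subst (λ j → seq P j ≡ D) (+-assoc N n (proj₁ (infD P (N + n)))) (proj₂ (infD P (N + n)))

-- Each U keeps the deck size and each D removes one card, so after k letters a
-- deck of N cards holds N ∸ |P_k|_D cards and M^P(N) is the first k with
-- N ≤ |P_k|_D.  As |P_k|_D ≤ k, that k is at least N, and since
-- |P_{N+j}|_D = |P_N|_D + |P'_j|_D, it is N plus the first j with
-- N ∸ |P_N|_D ≤ |P'_j|_D, which is M^{P'}(N ∸ |P_N|_D).
module Submission where

open import Defs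
open import Data.Nat using (ℕ; zero; suc; _+_; _∸_; _≥_; _≤_; _<_; pred; z≤n; s≤s)
open import Data.Nat.Properties
open import Data.Bool using (true; false)
open import Data.Bool.Properties using (not-¬)
open import Data.List using (List; []; _∷_; null; length)
open import Data.List.Properties using (length-++; length-upTo)
open import Data.Product using (_×_; _,_; proj₁; proj₂)
open import Function using (_∘_)
open import Function.Bundles using (_⇔_; mk⇔; Equivalence)
open import Relation.Binary using (tri<; tri≈; tri>)
open import Relation.Binary.PropositionalEquality using (_≡_; refl; sym; trans; cong; subst; module ≡-Reasoning)
open import Relation.Nullary using (¬_; contradiction)

IsFirst : (ℕ → Set) → ℕ → Set
IsFirst Q k = Q k × (∀ {j} → j < k → ¬ Q j)

isFirst-unique : ∀ {Q k l} → IsFirst Q k → IsFirst Q l → k ≡ l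
isFirst-unique {k = k} {l} (Qk , before-k) (Ql , before-l) with <-cmp k l
... | tri< k<l _ _ = contradiction Qk (before-l k<l)
... | tri≈ _ k≡l _ = k≡l
... | tri> _ _ l<k = contradiction Ql (before-k l<k)

isFirst-cong : ∀ {Q R k} → (∀ j → Q j ⇔ R j) → IsFirst Q k → IsFirst R k
isFirst-cong Q⇔R (Qk , before) =
  Equivalence.to (Q⇔R _) Qk , λ j<k Rj → before j<k (Equivalence.from (Q⇔R _) Rj)

isFirst-shift : ∀ {Q} n {k} → IsFirst Q (n + k) → IsFirst (λ j → Q (n + j)) k
isFirst-shift n (Qnk , before) = Qnk , λ j<k → before (+-monoʳ-< n j<k)

least-isFirst : ∀ f b {j} → j ≤ b → f j ≡ true → IsFirst (λ k → f k ≡ true) (least f b)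
least-isFirst f zero z≤n fj = fj , λ ()
least-isFirst f (suc b) j≤b fj with f zero in f0
... | true = f0 , λ ()
least-isFirst f (suc b) {zero}  _         f0≡true | false = contradiction f0≡true (not-¬ f0)
least-isFirst f (suc b) {suc i} (s≤s i≤b) fsi     | false =
  let hit , before = least-isFirst (f ∘ suc) b i≤b fsi
  in  hit , λ { {zero} _ → not-¬ f0 ; {suc i} (s≤s i<k) → before i<k }

countD-+ : ∀ P n k → countD P (n + k) ≡ countD P n + countD (dropP n P) k
countD-+ P n zero = trans (cong (countD P) (+-identityʳ n)) (sym (+-identityʳ _))
countD-+ P n (suc k) rewrite +-suc n k with seq P (n + k)
... | D = trans (cong suc (countD-+ P n k)) (sym (+-suc _ _))
... | U = countD-+ P n k

countD≤ : ∀ P k → countD P k ≤ k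
countD≤ P zero = z≤n
countD≤ P (suc k) with seq P k
... | D = s≤s (countD≤ P k)
... | U = m≤n⇒m≤1+n (countD≤ P k)

countD-suc-D : ∀ P k → seq P k ≡ D → countD P (suc k) ≡ suc (countD P k)
countD-suc-D P k Pk≡D rewrite Pk≡D = refl

bnd-dealt : ∀ P n → n ≤ countD P (bnd P n)
bnd-dealt P zero = z≤n
bnd-dealt P (suc n) = begin
  suc n                                   ≤⟨ s≤s (bnd-dealt P n) ⟩
  suc (countD P b)                        ≤⟨ s≤s (m≤m+n _ _) ⟩
  suc (countD P b + countD (dropP b P) m) ≡⟨ cong suc (countD-+ P b m) ⟨
  suc (countD P (b + m))                  ≡⟨ countD-suc-D P (b + m) (proj₂ (infD P b)) ⟨
  countD P (suc (b + m))                  ∎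
  where
  open ≤-Reasoning
  b = bnd P n
  m = proj₁ (infD P b)

length-step-U : (xs : List ℕ) → length (step U xs) ≡ length xs
length-step-U []       = refl
length-step-U (x ∷ xs) = trans (length-++ xs) (+-comm (length xs) 1)

length-step-D : (xs : List ℕ) → length (step D xs) ≡ pred (length xs)
length-step-D []       = refl
length-step-D (x ∷ xs) = refl

length-deckAfter : ∀ P d k → length (deckAfter (seq P) d k) ≡ length d ∸ countD P k
length-deckAfter P d zero = refl
length-deckAfter P d (suc k) with seq P k
... | U = trans (length-step-U (deckAfter (seq P) d k)) (length-deckAfter P d k)
... | D = begin
  length (step D (deckAfter (seq P) d k)) ≡⟨ length-step-D (deckAfter (seq P) d k) ⟩
  pred (length (deckAfter (seq P) d k))   ≡⟨ cong pred (length-deckAfter P d k) ⟩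
  pred (length d ∸ countD P k)            ≡⟨ pred[m∸n]≡m∸[1+n] (length d) (countD P k) ⟩
  length d ∸ suc (countD P k)             ∎
  where open ≡-Reasoning

null⇔length≡0 : (xs : List ℕ) → (null xs ≡ true) ⇔ (length xs ≡ 0)
null⇔length≡0 []       = mk⇔ (λ _ → refl) (λ _ → refl)
null⇔length≡0 (x ∷ xs) = mk⇔ (λ ()) (λ ())

deckAfter-empty⇔ : ∀ P N k → (null (deckAfter (seq P) (deck N) k) ≡ true) ⇔ (N ≤ countD P k)
deckAfter-empty⇔ P N k = mk⇔
  (λ empty → m∸n≡0⇒m≤n (trans (sym size) (Equivalence.to (null⇔length≡0 _) empty)))
  (λ N≤c → Equivalence.from (null⇔length≡0 _) (trans size (m≤n⇒m∸n≡0 N≤c)))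
  where
  size : length (deckAfter (seq P) (deck N) k) ≡ N ∸ countD P k
  size = trans (length-deckAfter P (deck N) k) (cong (_∸ countD P k) (length-upTo N))

M-isFirst : ∀ P N → IsFirst (λ k → N ≤ countD P k) (M P N)
M-isFirst P N = isFirst-cong (deckAfter-empty⇔ P N)
  (least-isFirst _ (bnd P N) ≤-refl (Equivalence.from (deckAfter-empty⇔ P N (bnd P N)) (bnd-dealt P N)))

M≥N : ∀ P N → N ≤ M P N
M≥N P N = ≤-trans (proj₁ (M-isFirst P N)) (countD≤ P (M P N))

m≤n+o⇔m∸n≤o : ∀ m n o → (m ≤ n + o) ⇔ (m ∸ n ≤ o)
m≤n+o⇔m∸n≤o m n o = mk⇔ (m≤n+o⇒m∸n≤o m n) (λ m∸n≤o → ≤-trans (m≤n+m∸n m n) (+-monoʳ-≤ n m∸n≤o))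

dealt-drop⇔ : ∀ P n m j →
  (m ≤ countD P (n + j)) ⇔ (m ∸ countD P n ≤ countD (dropP n P) j)
dealt-drop⇔ P n m j rewrite countD-+ P n j = m≤n+o⇔m∸n≤o m (countD P n) (countD (dropP n P) j)

M-drop : ∀ P N → M P N ≡ M (dropP N P) (N ∸ countD P N) + N
M-drop P N = begin
  M P N       ≡⟨ N+K≡M ⟨
  N + K       ≡⟨ +-comm N K ⟩
  K + N       ≡⟨ cong (_+ N) (isFirst-unique (M-isFirst (dropP N P) (N ∸ countD P N)) K-isFirst) ⟨
  M (dropP N P) (N ∸ countD P N) + N ∎
  where
  open ≡-Reasoning
  K = M P N ∸ N
  N+K≡M : N + K ≡ M P N
  N+K≡M = m+[n∸m]≡n (M≥N P N)
  K-isFirst : IsFirst (λ j → N ∸ countD P N ≤ countD (dropP N P) j) K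
  K-isFirst = isFirst-cong (dealt-drop⇔ P N N)
    (isFirst-shift N (subst (IsFirst _) (sym N+K≡M) (M-isFirst P N)))

mainTheorem2 : (P : Pattern) →
    (M P 0 ≡ 0) × (∀ (N : ℕ) → N ≥ 1 → M P N ≡ M (dropP N P) (N ∸ countD P N) + N)
mainTheorem2 P = refl , λ N _ → M-drop P N
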